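{- Let $H=(V,E)$ be a finite bipartite graph with bipartition $V(H)=A\cup B$ and no isolated vertices. Let $p=|A|$, $q=|B|$, $r=|E(A,B)|=|E(H)|$, and assume $p\le q\le r$. If $H$ is not a star graph and $\min_{e\in E(H)}|S_1(e)|\ge |E(H)|-\frac{|V(H)|}{2}$, then: (1) if $p=q=r$, then $H=H_r^1$; (2) if $r$ is even, $p=2$ and $q=r$, then $H=H_r^2$; (3) if $r$ is even and $p=q=\frac r2+1$, then $H=H_r^3$; (4) if $r$ is odd and $p=q=\frac{r+1}{2}$, then $H=H_r^4$. Moreover, for every $H$ among $H_r^1$ ($r\ge2$), $H_r^2$ ($r$ even), $H_r^3$ ($r$ even), $H_r^4$ ($r$ odd, $r\ge3$), one has $\min_{e\in E(H)}|S_1(e)|=|E(H)|-\frac{|V(H)|}{2}$.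
   Context: For an edge $e$ of a graph, $S_1(e)$ denotes the set of edges different from $e$ that share an endpoint with $e$. A star graph is $K_{1,m}$ for some $m\ge1$. $E(A,B)$ is the set of edges with one end in $A$ and the other in $B$. The bipartite graphs (with the stated bipartition $A\cup B$, equality meaning isomorphism respecting the parts): $H_n^1$ ($n\ge1$) is the disjoint union of $n$ edges, $|A|=|B|=n$. $H_n^2$ ($n$ even) is the disjoint union of two copies of $K_{1,n/2}$ whose two centers form $A$ (so $|A|=2$, $|B|=n$). $H_n^3$ ($n$ even) is the disjoint union of two copies of $K_{1,n/2}$, one with center in $A$ and leaves in $B$, the other with center in $B$ and leaves in $A$ (so $|A|=|B|=n/2+1$). $H_n^4$ ($n$ odd, $n\ge3$), with $k=\frac{n+1}{2}$: $A=\{u_1,\dots,u_k\}$, $B=\{v_1,\dots,v_k\}$, edge set $\{u_1v_j:1\le j\le k\}\cup\{u_iv_k:1\le i\le k\}$. -}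

module Defs where

open import Data.Nat using (ℕ; zero; suc; _+_; _*_; _≤_; _<ᵇ_; _≡ᵇ_)
open import Data.Fin using (Fin; zero; suc; toℕ; _≟_)
open import Data.Bool using (Bool; true; false; _∧_; _∨_; not; if_then_else_; T)
open import Data.Sum using (_⊎_; inj₁; inj₂)
open import Data.Product using (Σ; ∃; _×_; _,_)
open import Data.Empty using (⊥)
open import Relation.Nullary using (¬_; does)
open import Relation.Binary.PropositionalEquality using (_≡_)
open import Function.Bundles using (_↔_; _⇔_; Inverse)

-- A finite bipartite (simple) graph with a fixed bipartition A ∪ B,
-- A = Fin p, B = Fin q; edges are the pairs (i , j) with adj i j ≡ true.
record BipGraph : Set where
  field
    p   : ℕ
    q   : ℕ
    adj : Fin p → Fin q → Bool
open BipGraph public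

sumFin : (n : ℕ) → (Fin n → ℕ) → ℕ
sumFin zero    f = 0
sumFin (suc n) f = f zero + sumFin n (λ i → f (suc i))

b2n : Bool → ℕ
b2n true  = 1
b2n false = 0

nV : BipGraph → ℕ
nV H = p H + q H

nE : BipGraph → ℕ
nE H = sumFin (p H) (λ i → sumFin (q H) (λ j → b2n (adj H i j)))

Edge : BipGraph → Set
Edge H = Σ (Fin (p H)) λ i → Σ (Fin (q H)) λ j → adj H i j ≡ true

S1 : (H : BipGraph) → Fin (p H) → Fin (q H) → ℕ
S1 H u v = sumFin (p H) λ u' → sumFin (q H) λ v' →
  b2n (adj H u' v'
       ∧ not (does (u' ≟ u) ∧ does (v' ≟ v))
       ∧ (does (u' ≟ u) ∨ does (v' ≟ v)))

NoIsolated : BipGraph → Set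
NoIsolated H = (∀ i → ∃ λ j → adj H i j ≡ true) × (∀ j → ∃ λ i → adj H i j ≡ true)

AdjV : (H : BipGraph) → Fin (p H) ⊎ Fin (q H) → Fin (p H) ⊎ Fin (q H) → Set
AdjV H (inj₁ i) (inj₂ j) = T (adj H i j)
AdjV H (inj₂ j) (inj₁ i) = T (adj H i j)
AdjV H (inj₁ _) (inj₁ _) = ⊥
AdjV H (inj₂ _) (inj₂ _) = ⊥

StarAdj : {m : ℕ} → Fin (suc m) → Fin (suc m) → Set
StarAdj x y = ¬ (x ≡ y) × ((x ≡ zero) ⊎ (y ≡ zero))

IsStar : BipGraph → Set
IsStar H = Σ ℕ λ m → (1 ≤ m) × Σ ((Fin (p H) ⊎ Fin (q H)) ↔ Fin (suc m)) λ f →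
  ∀ x y → AdjV H x y ⇔ StarAdj (Inverse.to f x) (Inverse.to f y)

_≅_ : BipGraph → BipGraph → Set
G ≅ H = Σ (Fin (p G) ↔ Fin (p H)) λ σ → Σ (Fin (q G) ↔ Fin (q H)) λ τ →
  ∀ i j → adj G i j ≡ adj H (Inverse.to σ i) (Inverse.to τ j)

isZero : {n : ℕ} → Fin n → Bool
isZero x = toℕ x ≡ᵇ 0

H1 : ℕ → BipGraph
H1 n = record { p = n ; q = n ; adj = λ i j → does (i ≟ j) }

-- H_n^2 with n = 2k : A = {a₀, a₁}, a₀ adjacent to the first k vertices of B,
-- a₁ to the last k
H2 : ℕ → BipGraph
H2 k = record { p = 2 ; q = 2 * k ; adj = a }
  where
  a : Fin 2 → Fin (2 * k) → Bool
  a zero    j = toℕ j <ᵇ k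
  a (suc _) j = not (toℕ j <ᵇ k)

-- H_n^3 with n = 2k : A = {u₀,…,u_k}, B = {v₀,…,v_k};
-- star u₀ – v₁…v_k and star v₀ – u₁…u_k
H3 : ℕ → BipGraph
H3 k = record { p = suc k ; q = suc k
              ; adj = λ i j → (isZero i ∧ not (isZero j)) ∨ (isZero j ∧ not (isZero i)) }

-- H_n^4 with n = 2k+1 (so (n+1)/2 = k+1): A = {u_1..u_{k+1}} ↦ Fin (k+1),
-- B = {v_1..v_{k+1}} ↦ Fin (k+1) (index shifted by one);
-- edges u_1 v_j (all j) and u_i v_{k+1} (all i)
H4 : ℕ → BipGraph
H4 k = record { p = suc k ; q = suc k
              ; adj = λ i j → isZero i ∨ (toℕ j ≡ᵇ k) }

-- min_{e ∈ E(H)} |S₁(e)| ≥ |E(H)| - |V(H)|/2, cleared of denominators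
MinS1≥ : BipGraph → Set
MinS1≥ H = ∀ (e : Edge H) → let (u , v , _) = e in
  2 * nE H ≤ 2 * S1 H u v + nV H

-- min_{e ∈ E(H)} |S₁(e)| = |E(H)| - |V(H)|/2 (min attained by some edge)
MinS1≡ : BipGraph → Set
MinS1≡ H = MinS1≥ H × Σ (Edge H) λ e → let (u , v , _) = e in
  2 * S1 H u v + nV H ≡ 2 * nE H

{-# OPTIONS --safe #-}
module Submission where

-- For an edge uv, inclusion–exclusion gives |S₁(uv)| = deg u + deg v − 2, so the hypothesis
-- says that deg u + deg v ≥ |E| − |V|/2 + 2 on every edge. Together with
-- Σ_A deg = Σ_B deg = |E| and the absence of isolated vertices this pins down the degrees.
-- In (1) every vertex is a leaf, so H is a perfect matching. In (2) every vertex of B is a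
-- leaf and both vertices of A have degree r/2. In (3) and (4), pigeonhole gives a leaf of B;
-- its neighbour u has degree ≥ k (resp. k + 1), so every other vertex of A is a leaf, and
-- the vertex v of B that u misses (resp. a hub of B found symmetrically) is adjacent to all
-- of A − u. The adjacency is then a fixed Boolean function of "i = u" and "j = v", and
-- relabelling u and v gives the isomorphism. Conversely, the degrees of H_r^1, …, H_r^4 are
-- explicit, and the bound is attained on an edge.

open import Defs
open import Data.Bool as Bool using (Bool; true; false; _∧_; _∨_; not)
open import Data.Bool.Properties
  using (¬-not; not-¬; not-involutive; ∨-zeroʳ; ∧-zeroʳ; ∧-identityʳ; ∧-assoc)
open import Data.Fin using (Fin; zero; suc; toℕ; fromℕ; join; punchIn; punchOut; cast; _≟_)
open import Data.Fin.Permutation as Perm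
  using (Permutation; _⟨$⟩ʳ_; _⟨$⟩ˡ_; permutation; inverseˡ; inverseʳ; cast-id; transpose; _∘ₚ_)
open import Data.Fin.Properties
  using (punchIn-punchOut; punchInᵢ≢i; toℕ-injective; toℕ-fromℕ; toℕ<n; toℕ-↑ˡ; toℕ-↑ʳ;
         toℕ-cast; +↔⊎; ¬∀⟶∃¬)
open import Data.Nat as ℕ
  using (ℕ; zero; suc; _+_; _*_; _≤_; _<_; _<ᵇ_; _≡ᵇ_; z≤n; s≤s; s≤s⁻¹)
open import Data.Nat.Properties
  using (suc-injective; +-comm; +-assoc; +-suc; +-identityʳ; *-comm; *-identityʳ; *-zeroʳ;
         ≤-reflexive; ≤-trans; ≤-antisym; n≤1+n; m≤m+n; <⇒≱; ≰⇒>; m+n≮m; _≤?_; _<?_;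
         +-mono-≤; +-monoˡ-≤; +-monoʳ-≤; *-monoʳ-≤;
         +-cancelˡ-≡; +-cancelʳ-≤; +-cancelˡ-≤; *-cancelˡ-≤; +-0-commutativeMonoid; module ≤-Reasoning)
open import Algebra.Properties.CommutativeMonoid.Sum +-0-commutativeMonoid
  using (sum; sum-remove; ∑-distrib-+; ∑-comm)
open import Data.Nat.Tactic.RingSolver using (solve-∀)
open import Data.Product using (Σ; ∃; _×_; _,_; proj₁; proj₂; map₂; swap)
open import Data.Sum as Sum using (_⊎_; inj₁; inj₂; [_,_]′)
open import Data.Sum.Properties using (swap-↔)
open import Data.Vec.Functional using (removeAt)
open import Function
  using (_∘_; flip; const; case_of_; _↔_; mk↔ₛ′; Inverse; _⇔_; mk⇔; Equivalence; Injection)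
open import Function.Properties.Inverse using (↔⇒↣; ↔-trans; ↔-sym)
open import Relation.Nullary using (¬_; Dec; does; yes; no; contradiction)
open import Relation.Nullary.Decidable using (dec-true; dec-false; does-⇔)
open import Relation.Binary.PropositionalEquality
  using (_≡_; _≢_; refl; sym; trans; subst; subst₂; cong; cong₂; module ≡-Reasoning)

open Inverse using (to; from; strictlyInverseˡ; strictlyInverseʳ)

-- Sums over Fin

sumFin≗sum : ∀ n (f : Fin n → ℕ) → sumFin n f ≡ sum f
sumFin≗sum zero    f = refl
sumFin≗sum (suc n) f = cong (f zero +_) (sumFin≗sum n (f ∘ suc))

sumFin-cong : ∀ n {f g : Fin n → ℕ} → (∀ i → f i ≡ g i) → sumFin n f ≡ sumFin n g
sumFin-cong zero    f≗g = refl
sumFin-cong (suc n) f≗g = cong₂ _+_ (f≗g zero) (sumFin-cong n (f≗g ∘ suc))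

sumFin-distrib-+ : ∀ n (f g : Fin n → ℕ) →
                   sumFin n (λ i → f i + g i) ≡ sumFin n f + sumFin n g
sumFin-distrib-+ n f g = begin
  sumFin n (λ i → f i + g i) ≡⟨ sumFin≗sum n _ ⟩
  sum (λ i → f i + g i)      ≡⟨ ∑-distrib-+ f g ⟩
  sum f + sum g              ≡⟨ cong₂ _+_ (sumFin≗sum n f) (sumFin≗sum n g) ⟨
  sumFin n f + sumFin n g    ∎
  where open ≡-Reasoning

sumFin-removeAt : ∀ {n} (f : Fin (suc n) → ℕ) i → sumFin (suc n) f ≡ f i + sumFin n (removeAt f i)
sumFin-removeAt {n} f i =
  trans (sumFin≗sum (suc n) f) (trans (sum-remove f) (cong (f i +_) (sym (sumFin≗sum n _))))

sumFin-const : ∀ n c → sumFin n (λ _ → c) ≡ n * c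
sumFin-const zero    c = refl
sumFin-const (suc n) c = cong (c +_) (sumFin-const n c)

sumFin-single : ∀ n (f : Fin n → ℕ) u → (∀ i → i ≢ u → f i ≡ 0) → sumFin n f ≡ f u
sumFin-single (suc n) f u f≡0 = begin
  sumFin (suc n) f               ≡⟨ sumFin-removeAt f u ⟩
  f u + sumFin n (removeAt f u)  ≡⟨ cong (f u +_) (sumFin-cong n (λ i → f≡0 _ (punchInᵢ≢i u i))) ⟩
  f u + sumFin n (λ _ → 0)       ≡⟨ cong (f u +_) (trans (sumFin-const n 0) (*-zeroʳ n)) ⟩
  f u + 0                        ≡⟨ +-identityʳ (f u) ⟩
  f u                            ∎
  where open ≡-Reasoning

sumFin² : ∀ m n → (Fin m → Fin n → ℕ) → ℕ
sumFin² m n f = sumFin m (λ i → sumFin n (f i))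

sumFin²-cong : ∀ m n {f g : Fin m → Fin n → ℕ} → (∀ i j → f i j ≡ g i j) →
               sumFin² m n f ≡ sumFin² m n g
sumFin²-cong m n f≗g = sumFin-cong m (λ i → sumFin-cong n (f≗g i))

sumFin²-distrib-+ : ∀ m n (f g : Fin m → Fin n → ℕ) →
                    sumFin² m n (λ i j → f i j + g i j) ≡ sumFin² m n f + sumFin² m n g
sumFin²-distrib-+ m n f g =
  trans (sumFin-cong m (λ i → sumFin-distrib-+ n (f i) (g i))) (sumFin-distrib-+ m _ _)

sumFin²≗sum² : ∀ m n (f : Fin m → Fin n → ℕ) → sumFin² m n f ≡ sum (λ i → sum (f i))
sumFin²≗sum² m n f = trans (sumFin-cong m (λ i → sumFin≗sum n (f i))) (sumFin≗sum m _)

sumFin²-comm : ∀ m n (f : Fin m → Fin n → ℕ) → sumFin² m n f ≡ sumFin² n m (flip f)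
sumFin²-comm m n f =
  trans (sumFin²≗sum² m n f) (trans (∑-comm f) (sym (sumFin²≗sum² n m (flip f))))

sumFin≤* : ∀ n c {f : Fin n → ℕ} → (∀ i → f i ≤ c) → sumFin n f ≤ n * c
sumFin≤* zero    c f≤c = z≤n
sumFin≤* (suc n) c f≤c = +-mono-≤ (f≤c zero) (sumFin≤* n c (f≤c ∘ suc))

*≤sumFin : ∀ n c {f : Fin n → ℕ} → (∀ i → c ≤ f i) → n * c ≤ sumFin n f
*≤sumFin zero    c c≤f = z≤n
*≤sumFin (suc n) c c≤f = +-mono-≤ (c≤f zero) (*≤sumFin n c (c≤f ∘ suc))

removeAt-punchOut : ∀ {n} (f : Fin (suc n) → ℕ) {i j} (i≢j : i ≢ j) →
                    removeAt f i (punchOut i≢j) ≡ f j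
removeAt-punchOut f i≢j = cong f (punchIn-punchOut i≢j)

≤-sumFin : ∀ {n} (f : Fin n → ℕ) i → f i ≤ sumFin n f
≤-sumFin {suc n} f i = ≤-trans (m≤m+n (f i) _) (≤-reflexive (sym (sumFin-removeAt f i)))

+-≤-sumFin : ∀ {n} (f : Fin n → ℕ) {i j} → i ≢ j → f i + f j ≤ sumFin n f
+-≤-sumFin {suc n} f {i} i≢j = begin
  f i + f _                          ≡⟨ cong (f i +_) (removeAt-punchOut f i≢j) ⟨
  f i + removeAt f i (punchOut i≢j)  ≤⟨ +-monoʳ-≤ (f i) (≤-sumFin (removeAt f i) _) ⟩
  f i + sumFin n (removeAt f i)      ≡⟨ sumFin-removeAt f i ⟨
  sumFin (suc n) f                   ∎
  where open ≤-Reasoning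

sumFin<n+n⇒∃≤1 : ∀ n (f : Fin n → ℕ) → sumFin n f < n + n → ∃ λ i → f i ≤ 1
sumFin<n+n⇒∃≤1 n f sum<n+n = map₂ (λ 2≰fi → s≤s⁻¹ (≰⇒> 2≰fi))
  (¬∀⟶∃¬ n (λ i → 2 ≤ f i) (λ i → 2 ≤? f i) λ 2≤f →
     <⇒≱ sum<n+n (≤-trans (≤-reflexive n+n≡n*2) (*≤sumFin n 2 2≤f)))
  where
  n+n≡n*2 : n + n ≡ n * 2
  n+n≡n*2 = trans (cong (n +_) (sym (+-identityʳ n))) (*-comm 2 n)

Positive : ∀ {n} → (Fin n → ℕ) → Set
Positive f = ∀ i → 1 ≤ f i

positive⇒n≤sumFin : ∀ {n} (f : Fin n → ℕ) → Positive f → n ≤ sumFin n f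
positive⇒n≤sumFin {n} f pos = ≤-trans (≤-reflexive (sym (*-identityʳ n))) (*≤sumFin n 1 pos)

positive⇒f+n≤1+sumFin : ∀ {n} (f : Fin n → ℕ) → Positive f → ∀ i → f i + n ≤ suc (sumFin n f)
positive⇒f+n≤1+sumFin {suc n} f pos i = begin
  f i + suc n                          ≡⟨ +-suc (f i) n ⟩
  suc (f i + n)                        ≤⟨ s≤s (+-monoʳ-≤ (f i) (positive⇒n≤sumFin _ (pos ∘ punchIn i))) ⟩
  suc (f i + sumFin n (removeAt f i))  ≡⟨ cong suc (sumFin-removeAt f i) ⟨
  suc (sumFin (suc n) f)               ∎
  where open ≤-Reasoning

positive⇒f+f+n≤2+sumFin : ∀ {n} (f : Fin n → ℕ) → Positive f → ∀ {i j} → i ≢ j →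
                          f i + f j + n ≤ suc (suc (sumFin n f))
positive⇒f+f+n≤2+sumFin {suc n} f pos {i} {j} i≢j = begin
  f i + f j + suc n                              ≡⟨ trans (+-suc (f i + f j) n) (cong suc (+-assoc (f i) (f j) n)) ⟩
  suc (f i + (f j + n))                          ≡⟨ cong (λ x → suc (f i + (x + n))) (removeAt-punchOut f i≢j) ⟨
  suc (f i + (removeAt f i (punchOut i≢j) + n))  ≤⟨ s≤s (+-monoʳ-≤ (f i) rest-bound) ⟩
  suc (f i + suc (sumFin n (removeAt f i)))      ≡⟨ cong suc (+-suc (f i) _) ⟩
  suc (suc (f i + sumFin n (removeAt f i)))      ≡⟨ cong (λ x → suc (suc x)) (sumFin-removeAt f i) ⟨
  suc (suc (sumFin (suc n) f))                   ∎
  where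
  open ≤-Reasoning
  rest-bound = positive⇒f+n≤1+sumFin (removeAt f i) (pos ∘ punchIn i) (punchOut i≢j)

sumFin≤n⇒≤1 : ∀ {n} (f : Fin n → ℕ) → Positive f → sumFin n f ≤ n → ∀ i → f i ≤ 1
sumFin≤n⇒≤1 {n} f pos sum≤n i =
  +-cancelʳ-≤ n (f i) 1 (≤-trans (positive⇒f+n≤1+sumFin f pos i) (s≤s sum≤n))

dominant⇒others≤1 : ∀ {n} (f : Fin n → ℕ) → Positive f → ∀ {a} → suc (sumFin n f) ≤ f a + n →
                    ∀ {i} → i ≢ a → f i ≤ 1
dominant⇒others≤1 {n} f pos {a} sum<fa+n {i} i≢a = +-cancelʳ-≤ (f a + n) (f i) 1 (begin
  f i + (f a + n)         ≡⟨ +-assoc (f i) (f a) n ⟨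
  f i + f a + n           ≤⟨ positive⇒f+f+n≤2+sumFin f pos i≢a ⟩
  suc (suc (sumFin n f))  ≤⟨ s≤s sum<fa+n ⟩
  suc (f a + n)           ∎)
  where open ≤-Reasoning

-- Counting

count : ∀ n → (Fin n → Bool) → ℕ
count n g = sumFin n (λ i → b2n (g i))

b2n≤1 : ∀ b → b2n b ≤ 1
b2n≤1 true  = s≤s z≤n
b2n≤1 false = z≤n

count≤n : ∀ n (g : Fin n → Bool) → count n g ≤ n
count≤n n g = ≤-trans (sumFin≤* n 1 (b2n≤1 ∘ g)) (≤-reflexive (*-identityʳ n))

count+count-not : ∀ n (P : Fin n → Bool) → count n P + count n (not ∘ P) ≡ n
count+count-not n P = begin
  count n P + count n (not ∘ P)                 ≡⟨ sumFin-distrib-+ n (b2n ∘ P) (b2n ∘ not ∘ P) ⟨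
  sumFin n (λ i → b2n (P i) + b2n (not (P i)))  ≡⟨ sumFin-cong n (λ i → b2n+b2n-not (P i)) ⟩
  sumFin n (λ _ → 1)                            ≡⟨ trans (sumFin-const n 1) (*-identityʳ n) ⟩
  n                                             ∎
  where
  open ≡-Reasoning
  b2n+b2n-not : ∀ b → b2n b + b2n (not b) ≡ 1
  b2n+b2n-not true  = refl
  b2n+b2n-not false = refl

count-∧-≟ : ∀ n (g : Fin n → Bool) u → count n (λ i → g i ∧ does (i ≟ u)) ≡ b2n (g u)
count-∧-≟ n g u = trans (sumFin-single n _ u off-u) (cong b2n at-u)
  where
  off-u : ∀ i → i ≢ u → b2n (g i ∧ does (i ≟ u)) ≡ 0
  off-u i i≢u = cong b2n (trans (cong (g i ∧_) (dec-false (i ≟ u) i≢u)) (∧-zeroʳ (g i)))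
  at-u : g u ∧ does (u ≟ u) ≡ g u
  at-u = trans (cong (g u ∧_) (dec-true (u ≟ u) refl)) (∧-identityʳ (g u))

count-≟ : ∀ n (u : Fin n) → count n (λ i → does (i ≟ u)) ≡ 1
count-≟ n u = count-∧-≟ n (const true) u

count-<ᵇ : ∀ n k → k ≤ n → count n (λ j → toℕ j <ᵇ k) ≡ k
count-<ᵇ n       zero    _         = trans (sumFin-const n 0) (*-zeroʳ n)
count-<ᵇ (suc n) (suc k) (s≤s k≤n) = cong suc (count-<ᵇ n k k≤n)

true⇒count-positive : ∀ {n} (g : Fin n → Bool) {i} → g i ≡ true → 1 ≤ count n g
true⇒count-positive g {i} gi = subst (_≤ count _ g) (cong b2n gi) (≤-sumFin _ i)

count≤1⇒unique : ∀ {n} (g : Fin n → Bool) → count n g ≤ 1 →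
                 ∀ {i j} → g i ≡ true → g j ≡ true → i ≡ j
count≤1⇒unique g count≤1 {i} {j} gi gj with i ≟ j
... | yes i≡j = i≡j
... | no  i≢j = contradiction (≤-trans 2≤count count≤1) λ { (s≤s ()) }
  where
  2≤count : 2 ≤ count _ g
  2≤count = subst (_≤ count _ g) (cong₂ (λ a b → b2n a + b2n b) gi gj) (+-≤-sumFin _ i≢j)

count≤1⇒other-false : ∀ {n} (g : Fin n → Bool) → count n g ≤ 1 →
                      ∀ {i j} → g i ≡ true → j ≢ i → g j ≡ false
count≤1⇒other-false g count≤1 gi j≢i = ¬-not λ gj → j≢i (count≤1⇒unique g count≤1 gj gi)

false⇒count<n : ∀ {n} (g : Fin n → Bool) {i} → g i ≡ false → count n g < n
false⇒count<n {suc n} g {i} gi = begin-strict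
  count (suc n) g                      ≡⟨ sumFin-removeAt (b2n ∘ g) i ⟩
  b2n (g i) + count n (g ∘ punchIn i)  ≡⟨ cong (λ b → b2n b + count n (g ∘ punchIn i)) gi ⟩
  count n (g ∘ punchIn i)              <⟨ s≤s (count≤n n _) ⟩
  suc n                                ∎
  where open ≤-Reasoning

two-false⇒1+count<n : ∀ {n} (g : Fin n → Bool) {i j} → i ≢ j → g i ≡ false → g j ≡ false →
                      suc (count n g) < n
two-false⇒1+count<n {suc n} g {i} i≢j gi gj = begin-strict
  suc (count (suc n) g)                      ≡⟨ cong suc (sumFin-removeAt (b2n ∘ g) i) ⟩
  suc (b2n (g i) + count n (g ∘ punchIn i))  ≡⟨ cong (λ b → suc (b2n b + count n (g ∘ punchIn i))) gi ⟩
  suc (count n (g ∘ punchIn i))              <⟨ s≤s (false⇒count<n (g ∘ punchIn i) rest-false) ⟩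
  suc n                                      ∎
  where
  open ≤-Reasoning
  rest-false = trans (cong g (punchIn-punchOut i≢j)) gj

count≥n⇒all : ∀ {n} (g : Fin n → Bool) → n ≤ count n g → ∀ j → g j ≡ true
count≥n⇒all g n≤count j = ¬-not λ gj → <⇒≱ (false⇒count<n g gj) n≤count

1+count≥n⇒all-but : ∀ {n} (g : Fin n → Bool) → n ≤ suc (count n g) →
                    ∀ {i} → g i ≡ false → ∀ {j} → j ≢ i → g j ≡ true
1+count≥n⇒all-but g n≤1+count gi j≢i =
  ¬-not λ gj → <⇒≱ (two-false⇒1+count<n g j≢i gj gi) n≤1+count

count<n⇒∃false : ∀ n (g : Fin n → Bool) → count n g < n → ∃ λ i → g i ≡ false
count<n⇒∃false n g count<n =
  map₂ ¬-not (¬∀⟶∃¬ n (λ i → g i ≡ true) (λ i → g i Bool.≟ true) λ all-true →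
    <⇒≱ count<n (positive⇒n≤sumFin _ λ i → ≤-reflexive (cong b2n (sym (all-true i)))))

-- Degrees and the condition on S₁

degA : (H : BipGraph) → Fin (p H) → ℕ
degA H i = count (q H) (adj H i)

degB : (H : BipGraph) → Fin (q H) → ℕ
degB H j = count (p H) (λ i → adj H i j)

nE≡sum-degB : (H : BipGraph) → nE H ≡ sumFin (q H) (degB H)
nE≡sum-degB H = sumFin²-comm (p H) (q H) _

degA-positive : (H : BipGraph) → NoIsolated H → Positive (degA H)
degA-positive H (nbrA , _) i = true⇒count-positive (adj H i) (proj₂ (nbrA i))

degB-positive : (H : BipGraph) → NoIsolated H → Positive (degB H)
degB-positive H (_ , nbrB) j = true⇒count-positive (λ i → adj H i j) (proj₂ (nbrB j))

inclusion-exclusion : ∀ g a b → b2n (g ∧ a ∧ b) + b2n (g ∧ a ∧ b) + b2n (g ∧ not (a ∧ b) ∧ (a ∨ b))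
                                ≡ b2n (g ∧ a) + b2n (g ∧ b)
inclusion-exclusion true  true  true  = refl
inclusion-exclusion true  true  false = refl
inclusion-exclusion true  false true  = refl
inclusion-exclusion true  false false = refl
inclusion-exclusion false a     b     = refl

2+S1≡degA+degB : (H : BipGraph) {u : Fin (p H)} {v : Fin (q H)} → adj H u v ≡ true →
                 2 + S1 H u v ≡ degA H u + degB H v
2+S1≡degA+degB H {u} {v} uv = begin
  2 + S1 H u v                                  ≡⟨ cong (λ x → x + x + S1 H u v) (trans ∑atUV (cong b2n uv)) ⟨
  ∑² atUV + ∑² atUV + ∑² onS1                   ≡⟨ cong (_+ ∑² onS1) (sumFin²-distrib-+ P Q atUV atUV) ⟨
  ∑² (λ i j → atUV i j + atUV i j) + ∑² onS1    ≡⟨ sumFin²-distrib-+ P Q _ onS1 ⟨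
  ∑² (λ i j → atUV i j + atUV i j + onS1 i j)   ≡⟨ sumFin²-cong P Q (λ i j → inclusion-exclusion (adj H i j) (a i) (b j)) ⟩
  ∑² (λ i j → atU i j + atV i j)                ≡⟨ sumFin²-distrib-+ P Q atU atV ⟩
  ∑² atU + ∑² atV                               ≡⟨ cong₂ _+_ ∑atU ∑atV ⟩
  degA H u + degB H v                           ∎
  where
  open ≡-Reasoning
  P = p H
  Q = q H
  ∑² = sumFin² P Q
  a : Fin P → Bool
  a i = does (i ≟ u)
  b : Fin Q → Bool
  b j = does (j ≟ v)
  onS1 atUV atU atV : Fin P → Fin Q → ℕ
  onS1 i j = b2n (adj H i j ∧ not (a i ∧ b j) ∧ (a i ∨ b j))
  atUV i j = b2n (adj H i j ∧ a i ∧ b j)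
  atU  i j = b2n (adj H i j ∧ a i)
  atV  i j = b2n (adj H i j ∧ b j)
  ∑atUV : ∑² atUV ≡ b2n (adj H u v)
  ∑atUV = begin
    ∑² atUV                                     ≡⟨ sumFin²-cong P Q (λ i j → cong b2n (∧-assoc (adj H i j) (a i) (b j))) ⟨
    ∑² (λ i j → b2n ((adj H i j ∧ a i) ∧ b j))  ≡⟨ sumFin-cong P (λ i → count-∧-≟ Q (λ j → adj H i j ∧ a i) v) ⟩
    count P (λ i → adj H i v ∧ a i)             ≡⟨ count-∧-≟ P (λ i → adj H i v) u ⟩
    b2n (adj H u v)                             ∎
  ∑atU : ∑² atU ≡ degA H u
  ∑atU = trans (sumFin²-comm P Q atU) (sumFin-cong Q (λ j → count-∧-≟ P (λ i → adj H i j) u))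
  ∑atV : ∑² atV ≡ degB H v
  ∑atV = sumFin-cong P (λ i → count-∧-≟ Q (adj H i) v)

2*s+[[1+k]+[1+k]]≡2*[k+[1+s]] : ∀ k s → 2 * s + (suc k + suc k) ≡ 2 * (k + suc s)
2*s+[[1+k]+[1+k]]≡2*[k+[1+s]] = solve-∀

-- With |V| = 2(k + 1) and |E| = k + x, the bound |S₁(uv)| ≥ |E| − |V|/2 is x − 1.
S1-bound⇔degree-bound : (H : BipGraph) {k x : ℕ} → nV H ≡ suc k + suc k → nE H ≡ k + x →
                        ∀ {u v} → adj H u v ≡ true →
                        (2 * nE H ≤ 2 * S1 H u v + nV H) ⇔ (suc x ≤ degA H u + degB H v)
S1-bound⇔degree-bound H {k} {x} nV≡ nE≡ {u} {v} uv = mk⇔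
  (λ h → subst (suc x ≤_) S1≡ (s≤s (+-cancelˡ-≤ k _ _ (*-cancelˡ-≤ 2 (subst₂ _≤_ lhs rhs h)))))
  (λ h → subst₂ _≤_ (sym lhs) (sym rhs) (*-monoʳ-≤ 2 (+-monoʳ-≤ k (s≤s⁻¹ (subst (suc x ≤_) (sym S1≡) h)))))
  where
  S1≡ = 2+S1≡degA+degB H uv
  lhs : 2 * nE H ≡ 2 * (k + x)
  lhs = cong (2 *_) nE≡
  rhs : 2 * S1 H u v + nV H ≡ 2 * (k + suc (S1 H u v))
  rhs = trans (cong (2 * S1 H u v +_) nV≡) (2*s+[[1+k]+[1+k]]≡2*[k+[1+s]] k (S1 H u v))

degree-tight⇒S1-tight : (H : BipGraph) {k x : ℕ} → nV H ≡ suc k + suc k → nE H ≡ k + x →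
                        ∀ {u v} → adj H u v ≡ true → degA H u + degB H v ≡ suc x →
                        2 * S1 H u v + nV H ≡ 2 * nE H
degree-tight⇒S1-tight H {k} {x} nV≡ nE≡ {u} {v} uv tight = begin
  2 * S1 H u v + nV H             ≡⟨ cong (2 * S1 H u v +_) nV≡ ⟩
  2 * S1 H u v + (suc k + suc k)  ≡⟨ 2*s+[[1+k]+[1+k]]≡2*[k+[1+s]] k (S1 H u v) ⟩
  2 * (k + suc (S1 H u v))        ≡⟨ cong (λ y → 2 * (k + y)) (suc-injective (trans (2+S1≡degA+degB H uv) tight)) ⟩
  2 * (k + x)                     ≡⟨ cong (2 *_) nE≡ ⟨
  2 * nE H                        ∎
  where open ≡-Reasoning

MinS1≥⇒degree-bound : (H : BipGraph) → MinS1≥ H → ∀ {k x} → nV H ≡ suc k + suc k → nE H ≡ k + x →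
                      ∀ {u v} → adj H u v ≡ true → suc x ≤ degA H u + degB H v
MinS1≥⇒degree-bound H minS1 nV≡ nE≡ uv =
  Equivalence.to (S1-bound⇔degree-bound H nV≡ nE≡ uv) (minS1 (_ , _ , uv))

degree-bound⇒MinS1≡ : (H : BipGraph) {k x : ℕ} → nV H ≡ suc k + suc k → nE H ≡ k + x →
                      (∀ {u v} → adj H u v ≡ true → suc x ≤ degA H u + degB H v) →
                      ∀ {u v} → adj H u v ≡ true → degA H u + degB H v ≡ suc x → MinS1≡ H
degree-bound⇒MinS1≡ H nV≡ nE≡ bound {u} {v} uv tight =
  (λ (_ , _ , e) → Equivalence.from (S1-bound⇔degree-bound H nV≡ nE≡ e) (bound e)) ,
  (u , v , uv) , degree-tight⇒S1-tight H nV≡ nE≡ uv tight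

suc≤+⇒≤ˡ : ∀ {x a b} → suc x ≤ a + b → b ≤ 1 → x ≤ a
suc≤+⇒≤ˡ {a = a} x<a+b b≤1 =
  s≤s⁻¹ (≤-trans x<a+b (≤-trans (+-monoʳ-≤ a b≤1) (≤-reflexive (+-comm a 1))))

suc≤+⇒≤ʳ : ∀ {x a b} → suc x ≤ a + b → a ≤ 1 → x ≤ b
suc≤+⇒≤ʳ {a = a} {b} x<a+b = suc≤+⇒≤ˡ (≤-trans x<a+b (≤-reflexive (+-comm a b)))

_ᵀ : BipGraph → BipGraph
H ᵀ = record { p = q H ; q = p H ; adj = flip (adj H) }

-- u is the neighbour of a vertex of B of degree ≤ 1, which exists by pigeonhole.
hub : (H : BipGraph) → NoIsolated H → sumFin (q H) (degB H) < q H + q H →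
      ∀ {x} → (∀ {u v} → adj H u v ≡ true → suc x ≤ degA H u + degB H v) → ∃ λ u → x ≤ degA H u
hub H (_ , nbrB) sum<2q bound =
  let (v , degB-v≤1) = sumFin<n+n⇒∃≤1 (q H) (degB H) sum<2q
      (u , uv)       = nbrB v
  in  u , suc≤+⇒≤ˡ (bound uv) degB-v≤1

-- Relabellings

≡does : ∀ {A : Set} {b : Bool} → (b ≡ true ⇔ A) → (a? : Dec A) → b ≡ does a?
≡does {b = true}  b⇔A a? = sym (dec-true a? (Equivalence.to b⇔A refl))
≡does {b = false} b⇔A a? = sym (dec-false a? λ a → case Equivalence.from b⇔A a of λ ())

does-≟-injective : ∀ {m n} (π : Permutation m n) (i j : Fin m) →
                   does (π ⟨$⟩ʳ i ≟ π ⟨$⟩ʳ j) ≡ does (i ≟ j)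
does-≟-injective π i j =
  does-⇔ (mk⇔ (Injection.injective (↔⇒↣ π)) (cong (π ⟨$⟩ʳ_))) (π ⟨$⟩ʳ i ≟ π ⟨$⟩ʳ j) (i ≟ j)

isZero≡does-≟-zero : ∀ {n} (i : Fin (suc n)) → isZero i ≡ does (i ≟ zero)
isZero≡does-≟-zero zero    = refl
isZero≡does-≟-zero (suc i) = refl

toℕ≡ᵇ≡does-≟-fromℕ : ∀ k (j : Fin (suc k)) → (toℕ j ≡ᵇ k) ≡ does (j ≟ fromℕ k)
toℕ≡ᵇ≡does-≟-fromℕ k j = does-⇔
  (mk⇔ (λ j≡k → toℕ-injective (trans j≡k (sym (toℕ-fromℕ k)))) λ { refl → toℕ-fromℕ k })
  (toℕ j ℕ.≟ k) (j ≟ fromℕ k)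

sending : ∀ {m n} → m ≡ n → Fin m → Fin n → Permutation m n
sending m≡n x y = cast-id m≡n ∘ₚ transpose (cast m≡n x) y

sending-sends : ∀ {m n} (m≡n : m ≡ n) x y → sending m≡n x y ⟨$⟩ʳ x ≡ y
sending-sends m≡n x y rewrite dec-true (cast m≡n x ≟ cast m≡n x) refl = refl

does-≟-sending : ∀ {m n} (m≡n : m ≡ n) x y i → does (sending m≡n x y ⟨$⟩ʳ i ≟ y) ≡ does (i ≟ x)
does-≟-sending m≡n x y i =
  trans (cong (λ z → does (π ⟨$⟩ʳ i ≟ z)) (sym (sending-sends m≡n x y))) (does-≟-injective π i x)
  where π = sending m≡n x y

-- The adjacency of the union of a star centred at u ∈ A and a star centred at v ∈ B, as a
-- function of whether uv is an edge, i = u and j = v.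
double-star : Bool → Bool → Bool → Bool
double-star uv true  true  = uv
double-star uv true  false = true
double-star uv false true  = true
double-star uv false false = false

double-star-adj : (H : BipGraph) {u : Fin (p H)} {v : Fin (q H)} {c : Bool} → adj H u v ≡ c →
                  (∀ {j} → j ≢ v → adj H u j ≡ true) → (∀ {i} → i ≢ u → adj H i v ≡ true) →
                  (∀ {i} → i ≢ u → degA H i ≤ 1) →
                  ∀ i j → adj H i j ≡ double-star c (does (i ≟ u)) (does (j ≟ v))
double-star-adj H {u} {v} uv≡c adj-u adj-v degA≤1 i j with i ≟ u | j ≟ v
... | yes refl | yes refl = uv≡c
... | yes refl | no j≢v   = adj-u j≢v
... | no i≢u   | yes refl = adj-v i≢u
... | no i≢u   | no j≢v   = count≤1⇒other-false (adj H i) (degA≤1 i≢u) (adj-v i≢u) j≢v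

≅-by-pattern : (φ : Bool → Bool → Bool) (G H : BipGraph) → p G ≡ p H → q G ≡ q H →
               ∀ {u v u′ v′} →
               (∀ i j → adj G i j ≡ φ (does (i ≟ u)) (does (j ≟ v))) →
               (∀ i j → adj H i j ≡ φ (does (i ≟ u′)) (does (j ≟ v′))) → G ≅ H
≅-by-pattern φ G H p≡p q≡q {u} {v} {u′} {v′} G-pattern H-pattern = σ , τ , adj≡
  where
  open ≡-Reasoning
  σ = sending p≡p u u′
  τ = sending q≡q v v′
  adj≡ : ∀ i j → adj G i j ≡ adj H (σ ⟨$⟩ʳ i) (τ ⟨$⟩ʳ j)
  adj≡ i j = begin
    adj G i j                                        ≡⟨ G-pattern i j ⟩
    φ (does (i ≟ u)) (does (j ≟ v))                  ≡⟨ cong₂ φ (does-≟-sending p≡p u u′ i) (does-≟-sending q≡q v v′ j) ⟨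
    φ (does (σ ⟨$⟩ʳ i ≟ u′)) (does (τ ⟨$⟩ʳ j ≟ v′))  ≡⟨ H-pattern _ _ ⟨
    adj H (σ ⟨$⟩ʳ i) (τ ⟨$⟩ʳ j)                      ∎

matching≅H1 : (H : BipGraph) → NoIsolated H → ∀ {n} → p H ≡ n →
              (∀ i → degA H i ≤ 1) → (∀ j → degB H j ≤ 1) → H ≅ H1 n
matching≅H1 H (nbrA , nbrB) p≡n degA≤1 degB≤1 = σ , τ , adj≡
  where
  σ : Permutation (p H) _
  σ = cast-id p≡n
  mate : Fin (q H) → Fin (p H)
  mate j = proj₁ (nbrB j)
  mate⁻¹ : Fin (p H) → Fin (q H)
  mate⁻¹ i = proj₁ (nbrA i)
  unique-in-row : ∀ i {j j′} → adj H i j ≡ true → adj H i j′ ≡ true → j ≡ j′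
  unique-in-row i = count≤1⇒unique (adj H i) (degA≤1 i)
  unique-in-column : ∀ j {i i′} → adj H i j ≡ true → adj H i′ j ≡ true → i ≡ i′
  unique-in-column j = count≤1⇒unique (λ i → adj H i j) (degB≤1 j)
  τ : Permutation (q H) _
  τ = permutation (λ j → σ ⟨$⟩ʳ mate j) (λ x → mate⁻¹ (σ ⟨$⟩ˡ x))
    (λ x → trans (cong (σ ⟨$⟩ʳ_) (unique-in-column _ (proj₂ (nbrB _)) (proj₂ (nbrA _)))) (inverseʳ σ))
    (λ j → trans (cong mate⁻¹ (inverseˡ σ)) (unique-in-row (mate j) (proj₂ (nbrA _)) (proj₂ (nbrB j))))
  adj≡ : ∀ i j → adj H i j ≡ does (σ ⟨$⟩ʳ i ≟ σ ⟨$⟩ʳ mate j)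
  adj≡ i j = trans (≡does (mk⇔ (λ ij → unique-in-column j ij (proj₂ (nbrB j))) λ { refl → proj₂ (nbrB j) })
                          (i ≟ mate j))
                   (sym (does-≟-injective σ i (mate j)))

isLeft : ∀ {A B : Set} → A ⊎ B → Bool
isLeft = [ const true , const false ]′

isLeft-map₁ : ∀ {A A′ B : Set} (f : A → A′) (s : A ⊎ B) → isLeft (Sum.map₁ f s) ≡ isLeft s
isLeft-map₁ f (inj₁ _) = refl
isLeft-map₁ f (inj₂ _) = refl

isLeft-swap : ∀ {A B : Set} (s : A ⊎ B) → isLeft (Sum.swap s) ≡ not (isLeft s)
isLeft-swap (inj₁ _) = refl
isLeft-swap (inj₂ _) = refl

consˡ : ∀ {n c d} → Fin n ↔ (Fin c ⊎ Fin d) → Fin (suc n) ↔ (Fin (suc c) ⊎ Fin d)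
consˡ {n} {c} {d} f = mk↔ₛ′ to′ from′ to∘from from∘to
  where
  to′ : Fin (suc n) → Fin (suc c) ⊎ Fin d
  to′ zero    = inj₁ zero
  to′ (suc j) = Sum.map₁ suc (to f j)
  from′ : Fin (suc c) ⊎ Fin d → Fin (suc n)
  from′ (inj₁ zero)    = zero
  from′ (inj₁ (suc x)) = suc (from f (inj₁ x))
  from′ (inj₂ y)       = suc (from f (inj₂ y))
  from′-map₁ : ∀ s → from′ (Sum.map₁ suc s) ≡ suc (from f s)
  from′-map₁ (inj₁ _) = refl
  from′-map₁ (inj₂ _) = refl
  to∘from : ∀ s → to′ (from′ s) ≡ s
  to∘from (inj₁ zero)    = refl
  to∘from (inj₁ (suc x)) = cong (Sum.map₁ suc) (strictlyInverseˡ f (inj₁ x))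
  to∘from (inj₂ y)       = cong (Sum.map₁ suc) (strictlyInverseˡ f (inj₂ y))
  from∘to : ∀ j → from′ (to′ j) ≡ j
  from∘to zero    = refl
  from∘to (suc j) = trans (from′-map₁ (to f j)) (cong suc (strictlyInverseʳ f j))

consʳ : ∀ {n c d} → Fin n ↔ (Fin c ⊎ Fin d) → Fin (suc n) ↔ (Fin c ⊎ Fin (suc d))
consʳ f = ↔-trans (consˡ (↔-trans f swap-↔)) swap-↔

isLeft-consʳ : ∀ {n c d} (f : Fin n ↔ (Fin c ⊎ Fin d)) j →
               isLeft (to (consʳ f) (suc j)) ≡ isLeft (to f j)
isLeft-consʳ f j = begin
  isLeft (Sum.swap (Sum.map₁ suc (Sum.swap (to f j))))  ≡⟨ isLeft-swap (Sum.map₁ suc (Sum.swap (to f j))) ⟩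
  not (isLeft (Sum.map₁ suc (Sum.swap (to f j))))       ≡⟨ cong not (isLeft-map₁ suc (Sum.swap (to f j))) ⟩
  not (isLeft (Sum.swap (to f j)))                      ≡⟨ cong not (isLeft-swap (to f j)) ⟩
  not (not (isLeft (to f j)))                           ≡⟨ not-involutive _ ⟩
  isLeft (to f j)                                       ∎
  where open ≡-Reasoning

partition : ∀ n (P : Fin n → Bool) →
            Σ (Fin n ↔ (Fin (count n P) ⊎ Fin (count n (not ∘ P)))) λ f → ∀ j → isLeft (to f j) ≡ P j
partition zero    P = mk↔ₛ′ (λ ()) [ (λ ()) , (λ ()) ]′ (λ { (inj₁ ()) ; (inj₂ ()) }) (λ ()) , λ ()
partition (suc n) P with P zero in P0 | partition n (P ∘ suc)
... | true  | f , f-splits = consˡ f , λ where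
  zero    → sym P0
  (suc j) → trans (isLeft-map₁ suc (to f j)) (f-splits j)
... | false | f , f-splits = consʳ f , λ where
  zero    → sym P0
  (suc j) → trans (isLeft-consʳ f j) (f-splits j)

join-<ᵇ : ∀ c d (s : Fin c ⊎ Fin d) → (toℕ (join c d s) <ᵇ c) ≡ isLeft s
join-<ᵇ c d (inj₁ x) = trans (cong (_<ᵇ c) (toℕ-↑ˡ x d)) (dec-true (toℕ x <? c) (toℕ<n x))
join-<ᵇ c d (inj₂ y) = trans (cong (_<ᵇ c) (toℕ-↑ʳ c y)) (dec-false (c + toℕ y <? c) (m+n≮m c (toℕ y)))

prefix↔ : ∀ {n m} (P : Fin n → Bool) → n ≡ m →
          Σ (Fin n ↔ Fin m) λ τ → ∀ j → (toℕ (τ ⟨$⟩ʳ j) <ᵇ count n P) ≡ P j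
prefix↔ {n} P n≡m = τ , τ-prefix
  where
  c = count n P
  d = count n (not ∘ P)
  split = partition n P
  τ = ↔-trans (proj₁ split) (↔-trans (↔-sym +↔⊎) (cast-id (trans (count+count-not n P) n≡m)))
  τ-prefix : ∀ j → (toℕ (τ ⟨$⟩ʳ j) <ᵇ c) ≡ P j
  τ-prefix j = begin
    toℕ (τ ⟨$⟩ʳ j) <ᵇ c                       ≡⟨ cong (_<ᵇ c) (toℕ-cast _ (join c d (to (proj₁ split) j))) ⟩
    toℕ (join c d (to (proj₁ split) j)) <ᵇ c  ≡⟨ join-<ᵇ c d (to (proj₁ split) j) ⟩
    isLeft (to (proj₁ split) j)               ≡⟨ proj₂ split j ⟩
    P j                                       ∎
    where open ≡-Reasoning

-- The four extremal graphs

≅H1 : (H : BipGraph) → NoIsolated H → p H ≡ q H → q H ≡ nE H → H ≅ H1 (nE H)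
≅H1 H ni p≡q q≡nE = matching≅H1 H ni p≡nE
  (sumFin≤n⇒≤1 (degA H) (degA-positive H ni) (≤-reflexive (sym p≡nE)))
  (sumFin≤n⇒≤1 (degB H) (degB-positive H ni) (≤-reflexive (trans (sym (nE≡sum-degB H)) (sym q≡nE))))
  where p≡nE = trans p≡q q≡nE

≅H2 : (H : BipGraph) → NoIsolated H → MinS1≥ H →
      ∀ k → nE H ≡ 2 * k → p H ≡ 2 → q H ≡ nE H → H ≅ H2 k
≅H2 H@record{} ni@(nbrA , nbrB) minS1 k nE≡2k refl q≡nE = Perm.id , τ , adj≡
  where
  nE≡k+k : nE H ≡ k + k
  nE≡k+k = trans nE≡2k (cong (k +_) (+-identityʳ k))
  nV≡ : nV H ≡ suc k + suc k
  nV≡ = trans (cong (2 +_) (trans q≡nE nE≡k+k)) (cong suc (sym (+-suc k k)))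
  degB≤1 : ∀ j → degB H j ≤ 1
  degB≤1 = sumFin≤n⇒≤1 (degB H) (degB-positive H ni)
                       (≤-reflexive (trans (sym (nE≡sum-degB H)) (sym q≡nE)))
  k≤degA : ∀ i → k ≤ degA H i
  k≤degA i = let (j , ij) = nbrA i in
    suc≤+⇒≤ˡ (MinS1≥⇒degree-bound H minS1 nV≡ nE≡k+k ij) (degB≤1 j)
  degA₀≡k : degA H zero ≡ k
  degA₀≡k = ≤-antisym (+-cancelʳ-≤ k _ _ (begin
    degA H zero + k                  ≤⟨ +-monoʳ-≤ (degA H zero) (k≤degA (suc zero)) ⟩
    degA H zero + degA H (suc zero)  ≡⟨ cong (degA H zero +_) (+-identityʳ _) ⟨
    nE H                             ≡⟨ nE≡k+k ⟩
    k + k                            ∎)) (k≤degA zero)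
    where open ≤-Reasoning
  prefix = prefix↔ (adj H zero) (trans q≡nE nE≡2k)
  τ = proj₁ prefix
  complement : ∀ j → adj H (suc zero) j ≡ not (adj H zero j)
  complement j with adj H zero j in 0j | nbrB j
  ... | true  | _             = count≤1⇒other-false (λ i → adj H i j) (degB≤1 j) 0j λ ()
  ... | false | zero , 0j′    = contradiction 0j′ (not-¬ 0j)
  ... | false | suc zero , 1j = 1j
  adj≡ : ∀ i j → adj H i j ≡ adj (H2 k) (Perm.id ⟨$⟩ʳ i) (τ ⟨$⟩ʳ j)
  adj≡ zero       j = trans (sym (proj₂ prefix j)) (cong (toℕ (τ ⟨$⟩ʳ j) <ᵇ_) degA₀≡k)
  adj≡ (suc zero) j = trans (complement j) (cong not (adj≡ zero j))

≅H3 : (H : BipGraph) → NoIsolated H → MinS1≥ H →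
      ∀ k → nE H ≡ 2 * k → p H ≡ suc k → q H ≡ suc k → H ≅ H3 k
≅H3 H@record{} ni@(_ , nbrB) minS1 k nE≡2k refl refl =
  ≅-by-pattern (double-star false) H (H3 k) refl refl
    (double-star-adj H ¬uv adj-u adj-v degA≤1) H3-pattern
  where
  H3-pattern : ∀ i j → adj (H3 k) i j ≡ double-star false (does (i ≟ zero)) (does (j ≟ zero))
  H3-pattern zero    zero    = refl
  H3-pattern zero    (suc _) = refl
  H3-pattern (suc _) zero    = refl
  H3-pattern (suc _) (suc _) = refl
  nE≡k+k : nE H ≡ k + k
  nE≡k+k = trans nE≡2k (cong (k +_) (+-identityʳ k))
  bound : ∀ {u v} → adj H u v ≡ true → suc k ≤ degA H u + degB H v
  bound = MinS1≥⇒degree-bound H minS1 refl nE≡k+k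
  A-hub = hub H ni (s≤s (≤-trans (≤-reflexive (trans (sym (nE≡sum-degB H)) nE≡k+k))
                                 (+-monoʳ-≤ k (n≤1+n k)))) bound
  u = proj₁ A-hub
  1+sum-degA≡ : suc (sumFin (suc k) (degA H)) ≡ k + suc k
  1+sum-degA≡ = trans (cong suc nE≡k+k) (sym (+-suc k k))
  degA≤1 : ∀ {i} → i ≢ u → degA H i ≤ 1
  degA≤1 = dominant⇒others≤1 (degA H) (degA-positive H ni)
             (≤-trans (≤-reflexive 1+sum-degA≡) (+-monoˡ-≤ (suc k) (proj₂ A-hub)))
  degA-u≤k : degA H u ≤ k
  degA-u≤k = +-cancelʳ-≤ (suc k) _ _
    (≤-trans (positive⇒f+n≤1+sumFin (degA H) (degA-positive H ni) u) (≤-reflexive 1+sum-degA≡))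
  non-neighbour = count<n⇒∃false (suc k) (adj H u) (s≤s degA-u≤k)
  v = proj₁ non-neighbour
  ¬uv : adj H u v ≡ false
  ¬uv = proj₂ non-neighbour
  k≤degB-v : k ≤ degB H v
  k≤degB-v = let (i , iv) = nbrB v in
    suc≤+⇒≤ʳ (bound iv) (degA≤1 λ i≡u → not-¬ ¬uv (subst (λ i → adj H i v ≡ true) i≡u iv))
  adj-u : ∀ {j} → j ≢ v → adj H u j ≡ true
  adj-u = 1+count≥n⇒all-but (adj H u) (s≤s (proj₂ A-hub)) ¬uv
  adj-v : ∀ {i} → i ≢ u → adj H i v ≡ true
  adj-v = 1+count≥n⇒all-but (λ i → adj H i v) (s≤s k≤degB-v) ¬uv

≅H4 : (H : BipGraph) → NoIsolated H → MinS1≥ H →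
      ∀ k → nE H ≡ 2 * k + 1 → p H ≡ suc k → q H ≡ suc k → H ≅ H4 k
≅H4 H@record{} ni minS1 k nE≡2k+1 refl refl =
  ≅-by-pattern (double-star true) H (H4 k) refl refl
    (double-star-adj H (adj-u v) (λ _ → adj-u _) (λ _ → adj-v _) degA≤1) H4-pattern
  where
  H4-pattern : ∀ i j → adj (H4 k) i j ≡ double-star true (does (i ≟ zero)) (does (j ≟ fromℕ k))
  H4-pattern i j = trans (cong₂ _∨_ (isZero≡does-≟-zero i) (toℕ≡ᵇ≡does-≟-fromℕ k j)) (∨≡double-star-true _ _)
    where
    ∨≡double-star-true : ∀ a b → a ∨ b ≡ double-star true a b
    ∨≡double-star-true true  true  = refl
    ∨≡double-star-true true  false = refl
    ∨≡double-star-true false true  = refl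
    ∨≡double-star-true false false = refl
  nE≡k+1+k : nE H ≡ k + suc k
  nE≡k+1+k = trans nE≡2k+1 (trans (+-comm (2 * k) 1)
               (trans (cong (λ x → suc (k + x)) (+-identityʳ k)) (sym (+-suc k k))))
  bound : ∀ {u v} → adj H u v ≡ true → suc (suc k) ≤ degA H u + degB H v
  bound = MinS1≥⇒degree-bound H minS1 refl nE≡k+1+k
  A-hub = hub H ni (s≤s (≤-reflexive (trans (sym (nE≡sum-degB H)) nE≡k+1+k))) bound
  B-hub = hub (H ᵀ) (swap ni) (s≤s (≤-reflexive nE≡k+1+k))
            λ {v} {u} uv → ≤-trans (bound uv) (≤-reflexive (+-comm (degA H u) (degB H v)))
  u = proj₁ A-hub
  v = proj₁ B-hub
  adj-u : ∀ j → adj H u j ≡ true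
  adj-u = count≥n⇒all (adj H u) (proj₂ A-hub)
  adj-v : ∀ i → adj H i v ≡ true
  adj-v = count≥n⇒all (λ i → adj H i v) (proj₂ B-hub)
  degA≤1 : ∀ {i} → i ≢ u → degA H i ≤ 1
  degA≤1 = dominant⇒others≤1 (degA H) (degA-positive H ni)
             (≤-trans (≤-reflexive (cong suc nE≡k+1+k)) (+-monoˡ-≤ (suc k) (proj₂ A-hub)))

H1-MinS1≡ : ∀ n → MinS1≡ (H1 (suc n))
H1-MinS1≡ n =
  degree-bound⇒MinS1≡ H {n} {1} refl nE≡n+1 (λ {u} {v} _ → ≤-reflexive (sym (deg≡2 {u} {v})))
    {zero} {zero} refl (deg≡2 {zero} {zero})
  where
  H = H1 (suc n)
  degA≡1 : ∀ i → degA H i ≡ 1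
  degA≡1 i = trans (sumFin-cong (suc n) λ j → cong b2n (does-⇔ (mk⇔ sym sym) (i ≟ j) (j ≟ i)))
                   (count-≟ (suc n) i)
  deg≡2 : ∀ {u v} → degA H u + degB H v ≡ 2
  deg≡2 {u} {v} = cong₂ _+_ (degA≡1 u) (count-≟ (suc n) v)
  nE≡n+1 : nE H ≡ n + 1
  nE≡n+1 = trans (sumFin-cong (suc n) degA≡1)
             (trans (sumFin-const (suc n) 1) (trans (*-identityʳ (suc n)) (+-comm 1 n)))

H2-MinS1≡ : ∀ k → MinS1≡ (H2 (suc k))
H2-MinS1≡ k = degree-bound⇒MinS1≡ H {K} {K} nV≡ nE≡K+K (λ {u} {v} _ → ≤-reflexive (sym (deg≡1+K u v)))
                                  {zero} {zero} refl (deg≡1+K zero zero)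
  where
  K = suc k
  H = H2 K
  degA₀≡K : degA H zero ≡ K
  degA₀≡K = count-<ᵇ (2 * K) K (m≤m+n K _)
  degA₁≡K : degA H (suc zero) ≡ K
  degA₁≡K = +-cancelˡ-≡ K _ _ (trans (cong (_+ degA H (suc zero)) (sym degA₀≡K))
              (trans (count+count-not (2 * K) (λ j → toℕ j <ᵇ K)) (cong (K +_) (+-identityʳ K))))
  degA≡K : ∀ i → degA H i ≡ K
  degA≡K zero       = degA₀≡K
  degA≡K (suc zero) = degA₁≡K
  degB≡1 : ∀ j → degB H j ≡ 1
  degB≡1 j with toℕ j <ᵇ K
  ... | true  = refl
  ... | false = refl
  deg≡1+K : ∀ u v → degA H u + degB H v ≡ suc K
  deg≡1+K u v = trans (cong₂ _+_ (degA≡K u) (degB≡1 v)) (+-comm K 1)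
  nE≡K+K : nE H ≡ K + K
  nE≡K+K = cong₂ _+_ degA₀≡K (trans (+-identityʳ _) degA₁≡K)
  nV≡ : nV H ≡ suc K + suc K
  nV≡ = cong suc (trans (cong (λ y → suc (K + y)) (+-identityʳ K)) (sym (+-suc K K)))

H3-MinS1≡ : ∀ k → MinS1≡ (H3 (suc k))
H3-MinS1≡ k = degree-bound⇒MinS1≡ H {K} {K} refl nE≡K+K (λ {u} {v} uv → ≤-reflexive (sym (deg≡1+K {u} {v} uv)))
                                  {zero} {suc zero} refl (deg≡1+K {zero} {suc zero} refl)
  where
  K = suc k
  H = H3 K
  K-ones : sumFin K (λ _ → 1) ≡ K
  K-ones = trans (sumFin-const K 1) (*-identityʳ K)
  K-zeros : sumFin K (λ _ → 0) ≡ 0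
  K-zeros = trans (sumFin-const K 0) (*-zeroʳ K)
  deg≡1+K : ∀ {u v} → adj H u v ≡ true → degA H u + degB H v ≡ suc K
  deg≡1+K {zero}  {suc _} _ = trans (cong₂ _+_ K-ones (cong suc K-zeros)) (+-comm K 1)
  deg≡1+K {suc _} {zero}  _ = cong₂ _+_ (cong suc K-zeros) K-ones
  nE≡K+K : nE H ≡ K + K
  nE≡K+K = cong₂ _+_ K-ones (trans (sumFin-cong K λ _ → cong suc K-zeros) K-ones)

H4-MinS1≡ : ∀ k → MinS1≡ (H4 (suc k))
H4-MinS1≡ k = degree-bound⇒MinS1≡ H {K} {suc K} refl nE≡K+1+K (λ {u} {v} → bound {u} {v})
                                  {zero} {zero} refl tight
  where
  K = suc k
  H = H4 K
  K-ones : sumFin K (λ _ → 1) ≡ K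
  K-ones = trans (sumFin-const K 1) (*-identityʳ K)
  degA₀≡1+K : degA H zero ≡ suc K
  degA₀≡1+K = cong suc K-ones
  degA-suc≡1 : ∀ i → degA H (suc i) ≡ 1
  degA-suc≡1 i = trans (sumFin-cong (suc K) λ j → cong b2n (toℕ≡ᵇ≡does-≟-fromℕ K j))
                       (count-≟ (suc K) (fromℕ K))
  nE≡K+1+K : nE H ≡ K + suc K
  nE≡K+1+K = trans (cong₂ _+_ degA₀≡1+K (trans (sumFin-cong K degA-suc≡1) K-ones)) (+-comm (suc K) K)
  bound : ∀ {u v} → adj H u v ≡ true → suc (suc K) ≤ degA H u + degB H v
  bound {zero}  {v} _  = begin
    suc (suc K)             ≡⟨ +-comm 1 (suc K) ⟩
    suc K + 1               ≤⟨ +-monoʳ-≤ (suc K) (true⇒count-positive (λ i → adj H i v) {zero} refl) ⟩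
    suc K + degB H v        ≡⟨ cong (_+ degB H v) degA₀≡1+K ⟨
    degA H zero + degB H v  ∎
    where open ≤-Reasoning
  bound {suc i} {v} uv = +-mono-≤ (true⇒count-positive (adj H (suc i)) {v} uv)
    (positive⇒n≤sumFin _ λ i′ → ≤-reflexive (cong b2n (sym (trans (cong (isZero i′ ∨_) uv) (∨-zeroʳ _)))))
  tight : degA H zero + degB H zero ≡ suc (suc K)
  tight = trans (cong₂ _+_ degA₀≡1+K (cong suc (trans (sumFin-const K 0) (*-zeroʳ K)))) (+-comm (suc K) 1)

-- The hypotheses 1 ≤ |V|, p ≤ q ≤ r and "not a star" are not needed: each case fixes p, q and r.
lemma3p1 :
    ((H : BipGraph) →
      1 ≤ nV H → NoIsolated H →
      p H ≤ q H → q H ≤ nE H →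
      ¬ IsStar H → MinS1≥ H →
      (p H ≡ q H → q H ≡ nE H → H ≅ H1 (nE H))
      × (∀ k → nE H ≡ 2 * k → p H ≡ 2 → q H ≡ nE H → H ≅ H2 k)
      × (∀ k → nE H ≡ 2 * k → p H ≡ suc k → q H ≡ suc k → H ≅ H3 k)
      × (∀ k → nE H ≡ 2 * k + 1 → p H ≡ suc k → q H ≡ suc k → H ≅ H4 k))
    × ((∀ n → 2 ≤ n → MinS1≡ (H1 n))
      × (∀ k → 1 ≤ k → MinS1≡ (H2 k))
      × (∀ k → 1 ≤ k → MinS1≡ (H3 k))
      × (∀ k → 1 ≤ k → MinS1≡ (H4 k)))
lemma3p1 =
  (λ H _ noIsolated _ _ _ minS1 →
     ≅H1 H noIsolated , ≅H2 H noIsolated minS1 , ≅H3 H noIsolated minS1 , ≅H4 H noIsolated minS1) ,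
  (λ { zero () ; (suc n) _ → H1-MinS1≡ n }) ,
  (λ { zero () ; (suc k) _ → H2-MinS1≡ k }) ,
  (λ { zero () ; (suc k) _ → H3-MinS1≡ k }) ,
  (λ { zero () ; (suc k) _ → H4-MinS1≡ k })
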